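{- For every $n\ge 1$ and every $e\in\mathbf{I}_n(0012)$, $0\le \textsc{srpt}(e)\le\textsc{last}(e)\le n-1$.
   Context: An inversion sequence of length $n$ is a sequence $e=e_1\cdots e_n$ of integers with $0\le e_i\le i-1$. The reduction of a word replaces each occurrence of the $k$-th smallest distinct entry by $k-1$; $e$ contains a pattern $p$ if some subsequence (entries at increasing positions) has reduction $p$, and avoids $p$ otherwise. $\mathbf{I}_n(0012)$ is the set of inversion sequences of length $n$ avoiding $0012$. For $e\in\mathbf{I}_n(0012)$, $\mathcal{R}(e)$ is the set of values appearing at least twice in $e$, $\textsc{srpt}(e)=\min\mathcal{R}(e)$ with the convention $\textsc{srpt}(01\cdots(n-1))=n-1$, and $\textsc{last}(e)=e_n$. -}

module Defs where

open import Data.Nat using (ℕ; zero; suc; _≤_; _<_; _∸_; _⊓_; _≟_; _<?_; _≤?_)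
open import Data.Fin using (Fin; toℕ)
open import Data.List using (List; []; _∷_; length; filter; deduplicate; map; foldr)
open import Data.List.Relation.Binary.Sublist.Propositional using (_⊆_)
open import Data.Vec using (Vec; lookup; toList)
open import Data.Product using (∃; _×_)
open import Relation.Binary.PropositionalEquality using (_≡_)
open import Relation.Nullary using (¬_)

-- Inversion sequence of length n (0-indexed position i holds e_{i+1}, so 0 ≤ e_{i+1} ≤ i).
IsInversionSeq : ∀ {n} → Vec ℕ n → Set
IsInversionSeq {n} e = (i : Fin n) → lookup e i ≤ toℕ i

distinct : List ℕ → List ℕ
distinct = deduplicate _≟_

reduction : List ℕ → List ℕ
reduction w = map (λ x → length (filter (_<? x) (distinct w))) w

Contains : List ℕ → List ℕ → Set
Contains w p = ∃ λ s → (s ⊆ w) × (reduction s ≡ p)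

Avoids : List ℕ → List ℕ → Set
Avoids w p = ¬ Contains w p

InI0012 : ∀ {n} → Vec ℕ n → Set
InI0012 e = IsInversionSeq e × Avoids (toList e) (0 ∷ 0 ∷ 1 ∷ 2 ∷ [])

occ : ℕ → List ℕ → ℕ
occ v w = length (filter (v ≟_) w)

repeated : List ℕ → List ℕ
repeated w = filter (λ v → 2 ≤? occ v w) (distinct w)

-- srpt(e) = min R(e), with srpt = n-1 when R(e) is empty (i.e. e = 01…(n-1)).
srpt : ∀ {n} → Vec ℕ n → ℕ
srpt {n} e with repeated (toList e)
... | []     = n ∸ 1
... | x ∷ xs = foldr _⊓_ x xs

-- If the last entry v of an inversion sequence e of length n is n - 1 there is nothing to prove,
-- since every entry is at most n - 1. Otherwise look at the prefix e₀ ⋯ e_v. If it is 0 1 ⋯ v,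
-- then v occurs both at position v and at the end. If not, the first position p with e_p ≠ p has
-- e_p < p, so e_p is one of the fixed points 0 ⋯ p - 1 and occurs at positions e_p and p; then
-- e_p < p ≤ v. Either way a repeated value is at most v.
module Submission where

open import Defs
open import Data.Nat using (ℕ; zero; suc; pred; _≤_; _<_; _∸_; _⊓_; _≟_; _≤?_; z≤n; s≤s)
open import Data.Nat.Properties
  using (≤-refl; ≤-trans; <-trans; <-≤-trans; m<n⇒m<1+n; n<1+n; <⇒≤; ≤-pred; n≤1+n; m≤n⇒m<n∨m≡n; m≤n⇒m⊓o≤n; m≤n⇒o⊓m≤n)
open import Data.Fin using (Fin; toℕ; fromℕ<)
import Data.Fin as Fin
open import Data.Fin.Properties using (toℕ≤pred[n]; toℕ-fromℕ<)
open import Data.List using ([]; _∷_; foldr)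
open import Data.List.Properties using (filter-accept; filter-reject; foldr-preservesᵒ)
open import Data.List.Membership.Propositional using (_∈_)
open import Data.List.Membership.Propositional.Properties
  using (∈-filter⁺; ∈-filter⁻; ∈-deduplicate⁺; ∈-deduplicate⁻)
open import Data.List.Relation.Unary.Any using (here; there)
import Data.List.Relation.Unary.Any as ListAny
open import Data.Vec using (Vec; []; _∷_; lookup; last; toList)
import Data.Vec.Relation.Unary.Any as VecAny
open import Data.Vec.Relation.Unary.Any.Properties using (lookup-index)
open import Data.Vec.Membership.Propositional using () renaming (_∈_ to _∈ᵥ_)
open import Data.Vec.Membership.Propositional.Properties using (∈-toList⁻)
open import Data.Product using (∃; _×_; _,_; proj₁)
open import Data.Sum using (_⊎_; inj₁; inj₂)
open import Relation.Binary.PropositionalEquality using (_≡_; refl; sym; trans; cong; subst; subst₂)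
open import Relation.Nullary using (yes; no)
open import Function using (_∘_)

occ-≤-∷ : ∀ v y w → occ v w ≤ occ v (y ∷ w)
occ-≤-∷ v y w with v ≟ y
... | yes v≡y rewrite filter-accept (v ≟_) {xs = w} v≡y = n≤1+n _
... | no  v≢y rewrite filter-reject (v ≟_) {xs = w} v≢y = ≤-refl

occ-∷-self : ∀ v w → occ v (v ∷ w) ≡ suc (occ v w)
occ-∷-self v w rewrite filter-accept (v ≟_) {xs = w} refl = refl

∈⇒occ≥1 : ∀ {x w} → x ∈ w → 1 ≤ occ x w
∈⇒occ≥1 {w = x ∷ w} (here refl) rewrite occ-∷-self x w = s≤s z≤n
∈⇒occ≥1 {x} {y ∷ w} (there x∈w) = ≤-trans (∈⇒occ≥1 x∈w) (occ-≤-∷ x y w)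

∈-repeated⁺ : ∀ {x w} → x ∈ w → 2 ≤ occ x w → x ∈ repeated w
∈-repeated⁺ {w = w} x∈w = ∈-filter⁺ (λ v → 2 ≤? occ v w) (∈-deduplicate⁺ _≟_ x∈w)

∈-repeated⁻ : ∀ {x} w → x ∈ repeated w → x ∈ w
∈-repeated⁻ w x∈r = ∈-deduplicate⁻ _≟_ w (proj₁ (∈-filter⁻ (λ v → 2 ≤? occ v w) x∈r))

infixl 9 _!_

-- Positions beyond the end read as the junk value 0; all lemmas carry the bound i < n.
_!_ : ∀ {n} → Vec ℕ n → ℕ → ℕ
[]      ! _     = 0
(x ∷ e) ! zero  = x
(x ∷ e) ! suc i = e ! i

lookup≡! : ∀ {n} (e : Vec ℕ n) (i : Fin n) → lookup e i ≡ e ! toℕ i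
lookup≡! (x ∷ e) Fin.zero    = refl
lookup≡! (x ∷ e) (Fin.suc i) = lookup≡! e i

last≡! : ∀ {m} (e : Vec ℕ (suc m)) → last e ≡ e ! m
last≡! {zero}  (x ∷ [])    = refl
last≡! {suc m} (x ∷ y ∷ e) = last≡! (y ∷ e)

!-∈ : ∀ {n} (e : Vec ℕ n) {i} → i < n → e ! i ∈ toList e
!-∈ (x ∷ e) {zero}  _         = here refl
!-∈ (x ∷ e) {suc i} (s≤s i<n) = there (!-∈ e i<n)

occ-!-≥2 : ∀ {n} (e : Vec ℕ n) {i j} → i < j → j < n → e ! i ≡ e ! j → 2 ≤ occ (e ! j) (toList e)
occ-!-≥2 (x ∷ e) {zero}  {suc j} _         (s≤s j<n) refl
  rewrite occ-∷-self (e ! j) (toList e) = s≤s (∈⇒occ≥1 (!-∈ e j<n))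
occ-!-≥2 (x ∷ e) {suc i} {suc j} (s≤s i<j) (s≤s j<n) eq =
  ≤-trans (occ-!-≥2 e i<j j<n eq) (occ-≤-∷ (e ! j) x (toList e))

!-repeated : ∀ {n} (e : Vec ℕ n) {i j} → i < j → j < n → e ! i ≡ e ! j → e ! j ∈ repeated (toList e)
!-repeated e i<j j<n eq = ∈-repeated⁺ (!-∈ e j<n) (occ-!-≥2 e i<j j<n eq)

⊓-presᵒ-≤ : ∀ {y} a b → a ≤ y ⊎ b ≤ y → a ⊓ b ≤ y
⊓-presᵒ-≤ a b (inj₁ a≤y) = m≤n⇒m⊓o≤n b a≤y
⊓-presᵒ-≤ a b (inj₂ b≤y) = m≤n⇒o⊓m≤n a b≤y

foldr-⊓-≤-∈ : ∀ {y} x xs → y ∈ x ∷ xs → foldr _⊓_ x xs ≤ y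
foldr-⊓-≤-∈ x xs (here refl) =
  foldr-preservesᵒ ⊓-presᵒ-≤ x xs (inj₁ ≤-refl)
foldr-⊓-≤-∈ x xs (there y∈xs) =
  foldr-preservesᵒ ⊓-presᵒ-≤ x xs (inj₂ (ListAny.map (λ { refl → ≤-refl }) y∈xs))

srpt-≤-repeated : ∀ {n} (e : Vec ℕ n) {y} → y ∈ repeated (toList e) → srpt e ≤ y
srpt-≤-repeated e y∈r with repeated (toList e)
... | x ∷ xs = foldr-⊓-≤-∈ x xs y∈r

srpt-≤-bound : ∀ {n} (e : Vec ℕ n) {b} → n ∸ 1 ≤ b → (∀ {x} → x ∈ toList e → x ≤ b) → srpt e ≤ b
srpt-≤-bound e n∸1≤b entries≤b with repeated (toList e) in r≡
... | []     = n∸1≤b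
... | x ∷ xs = ≤-trans (foldr-⊓-≤-∈ x xs (here refl))
                       (entries≤b (∈-repeated⁻ (toList e) (subst (x ∈_) (sym r≡) (here refl))))

inversion-≤-pred : ∀ {n} (e : Vec ℕ n) → IsInversionSeq e → ∀ {x} → x ∈ toList e → x ≤ pred n
inversion-≤-pred {n} e inv {x} x∈e =
  subst (_≤ pred n) (sym (lookup-index x∈ᵥe)) (≤-trans (inv i) (toℕ≤pred[n] i))
  where
  x∈ᵥe : x ∈ᵥ e
  x∈ᵥe = ∈-toList⁻ x∈e
  i : Fin n
  i = VecAny.index x∈ᵥe

inversion-! : ∀ {n} (e : Vec ℕ n) → IsInversionSeq e → ∀ {i} → i < n → e ! i ≤ i
inversion-! {n} e inv {i} i<n =
  subst₂ _≤_ (trans (lookup≡! e k) (cong (e !_) toℕ[k]≡i)) toℕ[k]≡i (inv k)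
  where
  k : Fin n
  k = fromℕ< i<n
  toℕ[k]≡i : toℕ k ≡ i
  toℕ[k]≡i = toℕ-fromℕ< i<n

identity⊎fixedPointHitTwice : (f : ℕ → ℕ) (k : ℕ) → (∀ {i} → i < k → f i ≤ i) →
  (∀ {i} → i < k → f i ≡ i) ⊎ ∃ λ p → p < k × f p < p × f (f p) ≡ f p
identity⊎fixedPointHitTwice f zero    _    = inj₁ (λ ())
identity⊎fixedPointHitTwice f (suc k) f≤id
  with identity⊎fixedPointHitTwice f k (λ i<k → f≤id (m<n⇒m<1+n i<k))
... | inj₂ (p , p<k , fp<p , ffp≡fp) = inj₂ (p , m<n⇒m<1+n p<k , fp<p , ffp≡fp)
... | inj₁ id<k with m≤n⇒m<n∨m≡n (f≤id (n<1+n k))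
...   | inj₁ fk<k = inj₂ (k , n<1+n k , fk<k , id<k fk<k)
...   | inj₂ fk≡k = inj₁ id<1+k
  where
  id<1+k : ∀ {i} → i < suc k → f i ≡ i
  id<1+k (s≤s i≤k) with m≤n⇒m<n∨m≡n i≤k
  ... | inj₁ i<k  = id<k i<k
  ... | inj₂ refl = fk≡k

srpt≤last : ∀ {m} (e : Vec ℕ (suc m)) → IsInversionSeq e → srpt e ≤ last e
srpt≤last {m} e inv = subst (srpt e ≤_) (sym (last≡! e)) srpt≤v
  where
  v : ℕ
  v = e ! m

  <1+v⇒<1+m : v < m → ∀ {i} → i < suc v → i < suc m
  <1+v⇒<1+m v<m i<1+v = <-trans (<-≤-trans i<1+v v<m) (n<1+n m)

  srpt≤v : srpt e ≤ v
  srpt≤v with m≤n⇒m<n∨m≡n (inversion-! e inv (n<1+n m))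
  ... | inj₂ v≡m = subst (srpt e ≤_) (sym v≡m) (srpt-≤-bound e ≤-refl (inversion-≤-pred e inv))
  ... | inj₁ v<m with identity⊎fixedPointHitTwice (e !_) (suc v) (inversion-! e inv ∘ <1+v⇒<1+m v<m)
  ...   | inj₁ id≤v = srpt-≤-repeated e (!-repeated e v<m (n<1+n m) (id≤v (n<1+n v)))
  ...   | inj₂ (p , p<1+v , ep<p , eep≡ep) =
    ≤-trans (srpt-≤-repeated e (!-repeated e ep<p (<1+v⇒<1+m v<m p<1+v) eep≡ep))
            (≤-trans (<⇒≤ ep<p) (≤-pred p<1+v))

corollary2p3 : (m : ℕ) → (e : Vec ℕ (suc m)) → InI0012 e →
    (0 ≤ srpt e) × (srpt e ≤ last e) × (last e ≤ suc m ∸ 1)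
corollary2p3 m e (inv , _) = z≤n , srpt≤last e inv , last≤m
  where
  last≤m : last e ≤ m
  last≤m = subst (_≤ m) (sym (last≡! e)) (inversion-! e inv (n<1+n m))
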